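{- For every integer $n\ge 5$, $\mathrm{box}(\overline{L(K_n)})\le n-2$.
   Context: $K_n$ is the complete graph on $n$ vertices, $L(K_n)$ its line graph, and $\overline{L(K_n)}$ the complement of $L(K_n)$ (isomorphic to the Kneser graph $\mathrm{KG}(n,2)$). The boxicity $\mathrm{box}(H)$ is the minimum $d\ge 0$ such that $H$ is the intersection graph of a family of axis-parallel boxes in $\mathbb{R}^d$. -}

module Defs where

open import Data.Nat using (ℕ; _≤_; _∸_)
open import Data.Fin using (Fin; _<_)
open import Data.Product using (_×_; _,_; Σ; ∃; ∃-syntax; proj₁; proj₂)
open import Relation.Binary.PropositionalEquality using (_≡_; _≢_)
open import Relation.Nullary using (¬_)
open import Data.Sum using (_⊎_)
open import Function.Bundles using (_⇔_)

record Graph : Set₁ where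
  field
    V   : Set
    Adj : V → V → Set
open Graph public

-- Edges of K_n: 2-element subsets {i , j} of Fin n, written with i < j.
record Edge (n : ℕ) : Set where
  constructor edge
  field
    i   : Fin n
    j   : Fin n
    i<j : i < j
open Edge public

ShareEnd : {n : ℕ} → Edge n → Edge n → Set
ShareEnd e f = (i e ≡ i f) ⊎ (i e ≡ j f) ⊎ (j e ≡ i f) ⊎ (j e ≡ j f)

LKn : ℕ → Graph
LKn n = record { V = Edge n ; Adj = λ e f → e ≢ f × ShareEnd e f }

complement : Graph → Graph
complement G = record { V = V G ; Adj = λ u v → u ≢ v × ¬ Adj G u v }

record Box (d : ℕ) : Set where
  constructor box
  field
    lo : Fin d → ℕ
    hi : Fin d → ℕ
    lo≤hi : ∀ k → lo k ≤ hi k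
open Box public

Intersect : {d : ℕ} → Box d → Box d → Set
Intersect B C = ∀ k → (lo B k ≤ hi C k) × (lo C k ≤ hi B k)

IsBoxRep : (G : Graph) (d : ℕ) → (V G → Box d) → Set
IsBoxRep G d f = ∀ u v → u ≢ v → (Adj G u v ⇔ Intersect (f u) (f v))

BoxicityAtMost : Graph → ℕ → Set
BoxicityAtMost G k = ∃[ d ] (d ≤ k × ∃[ f ] IsBoxRep G d f)

-- Write a = 0, b = 1 and c_k = k + 2 (k < m) for the vertices of K_(m+2), and place them on a
-- line: a at 0, c_k at k + 1, b at m + 1.  In coordinate k an edge through c_k becomes the
-- point of its other endpoint; every other edge becomes [0, m + 1] with the position of a
-- cut off if the edge contains a, and that of b if it contains b.  Two edges sharing c_k are
-- then two distinct points in coordinate k, and two edges sharing a (or b) are separated in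
-- the coordinate of an inner endpoint of one of them.  Disjoint edges meet in every
-- coordinate: each cut interval contains [1, m], and the point of a vertex lies in the cut
-- interval of every edge avoiding that vertex.
module Submission where

open import Defs
open import Data.Nat using (ℕ; _≤_; _∸_; zero; suc; _⊔_; _⊓_; z≤n; s≤s)
open import Data.Nat.Properties
  using (≤-refl; n≤1+n; ≤-trans; ≤-antisym; <-irrefl; suc-injective; m≤m⊔n; m⊓n≤m; ⊔-lub; ⊓-glb; ⊔-comm; ⊓-comm)
open import Data.Fin using (Fin; zero; suc; toℕ)
open import Data.Fin.Properties using (_≟_; toℕ<n; toℕ≤n; toℕ-injective; <-asym; <-irrelevant)
open import Data.Product using (_×_; _,_; ∃-syntax; proj₁; proj₂)
open import Data.Sum using (_⊎_; inj₁; inj₂)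
open import Data.Empty using (⊥-elim)
open import Relation.Nullary using (¬_; yes; no)
open import Relation.Binary.PropositionalEquality using (_≡_; _≢_; refl; sym; trans; cong; cong₂; subst₂; ≢-sym)
open import Function.Bundles using (mk⇔)

Interval : Set
Interval = ℕ × ℕ

Overlap : Interval → Interval → Set
Overlap I J = proj₁ I ≤ proj₂ J × proj₁ J ≤ proj₂ I

overlap-sym : ∀ {I J} → Overlap I J → Overlap J I
overlap-sym (p , q) = q , p

point : ℕ → Interval
point p = p , p

overlapping-points-≡ : ∀ {p q} → Overlap (point p) (point q) → p ≡ q
overlapping-points-≡ (p≤q , q≤p) = ≤-antisym p≤q q≤p

boxOf : ∀ {d} (I : Fin d → Interval) → (∀ k → proj₁ (I k) ≤ proj₂ (I k)) → Box d
boxOf I nonempty = box (λ k → proj₁ (I k)) (λ k → proj₂ (I k)) nonempty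

complement-isBoxRep : ∀ (G : Graph) {d} (I : V G → Fin d → Interval)
  (nonempty : ∀ v k → proj₁ (I v k) ≤ proj₂ (I v k)) →
  (∀ u v → u ≢ v → ¬ Adj G u v → ∀ k → Overlap (I u k) (I v k)) →
  (∀ u v → u ≢ v → Adj G u v → ∃[ k ] ¬ Overlap (I u k) (I v k)) →
  IsBoxRep (complement G) d (λ v → boxOf (I v) (nonempty v))
complement-isBoxRep G I nonempty meet apart u v u≢v = mk⇔
  (λ (_ , ¬adj) → meet u v u≢v ¬adj)
  (λ meets → u≢v , λ adj → let (k , ¬overlap) = apart u v u≢v adj in ¬overlap (meets k))

module _ {n : ℕ} where

  data Ends (e : Edge n) : Fin n → Fin n → Set where
    forward  : Ends e (i e) (j e)
    backward : Ends e (j e) (i e)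

  edge-≡ : ∀ {e f : Edge n} → i e ≡ i f → j e ≡ j f → e ≡ f
  edge-≡ {edge x y x<y} {edge _ _ x<y′} refl refl with <-irrelevant x<y x<y′
  ... | refl = refl

  i≢j : ∀ (e : Edge n) → i e ≢ j e
  i≢j e i≡j = <-irrefl (cong toℕ i≡j) (i<j e)

  ends-≢ : ∀ {e x y} → Ends e x y → x ≢ y
  ends-≢ {e} forward  = i≢j e
  ends-≢ {e} backward = ≢-sym (i≢j e)

  shared-endpoint : ∀ {e f : Edge n} → e ≢ f → ShareEnd e f →
                    ∃[ s ] ∃[ y ] ∃[ y′ ] Ends e s y × Ends f s y′ × y ≢ y′
  shared-endpoint {edge a b a<b} {edge c d c<d} e≢f (inj₁ refl) =
    a , b , d , forward , forward , λ b≡d → e≢f (edge-≡ refl b≡d)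
  shared-endpoint {edge a b a<b} {edge c d c<d} e≢f (inj₂ (inj₁ refl)) =
    a , b , c , forward , backward , λ { refl → <-asym a<b c<d }
  shared-endpoint {edge a b a<b} {edge c d c<d} e≢f (inj₂ (inj₂ (inj₁ refl))) =
    b , a , d , backward , forward , λ { refl → <-asym a<b c<d }
  shared-endpoint {edge a b a<b} {edge c d c<d} e≢f (inj₂ (inj₂ (inj₂ refl))) =
    b , a , c , backward , backward , λ a≡c → e≢f (edge-≡ a≡c refl)

module KneserBoxes (m : ℕ) (1≤m : 1 ≤ m) where

  Vertex : Set
  Vertex = Fin (suc (suc m))

  pattern inner c = suc (suc c)

  data Outer : Vertex → Set where
    outer-a : Outer zero
    outer-b : Outer (suc zero)

  pos : Vertex → ℕ
  pos zero       = 0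
  pos (suc zero) = suc m
  pos (inner c)  = suc (toℕ c)

  pos-injective : ∀ {x y} → pos x ≡ pos y → x ≡ y
  pos-injective {zero}      {zero}      _ = refl
  pos-injective {zero}      {suc zero}  ()
  pos-injective {zero}      {inner _}   ()
  pos-injective {suc zero}  {zero}      ()
  pos-injective {inner _}   {zero}      ()
  pos-injective {suc zero}  {suc zero}  _ = refl
  pos-injective {suc zero}  {inner c}   p = ⊥-elim (<-irrefl (sym (suc-injective p)) (toℕ<n c))
  pos-injective {inner c}   {suc zero}  p = ⊥-elim (<-irrefl (suc-injective p) (toℕ<n c))
  pos-injective {inner _}   {inner _}   p = cong inner (toℕ-injective (suc-injective p))

  pos≤1+m : ∀ z → pos z ≤ suc m
  pos≤1+m zero       = z≤n
  pos≤1+m (suc zero) = ≤-refl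
  pos≤1+m (inner c)  = s≤s (toℕ≤n c)

  lower upper : Vertex → ℕ
  lower zero = 1
  lower _    = 0
  upper (suc zero) = m
  upper _          = suc m

  lower≤1 : ∀ x → lower x ≤ 1
  lower≤1 zero    = ≤-refl
  lower≤1 (suc _) = z≤n

  m≤upper : ∀ x → m ≤ upper x
  m≤upper zero       = n≤1+n m
  m≤upper (suc zero) = ≤-refl
  m≤upper (inner _)  = n≤1+n m

  lower≤pos : ∀ {z x} → z ≢ x → lower x ≤ pos z
  lower≤pos {zero}     {zero}  z≢x = ⊥-elim (z≢x refl)
  lower≤pos {suc zero} {zero}  _   = s≤s z≤n
  lower≤pos {inner _}  {zero}  _   = s≤s z≤n
  lower≤pos {x = suc _}        _   = z≤n

  pos≤upper : ∀ {z x} → z ≢ x → pos z ≤ upper x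
  pos≤upper {zero}     {suc zero} _   = z≤n
  pos≤upper {suc zero} {suc zero} z≢x = ⊥-elim (z≢x refl)
  pos≤upper {inner c}  {suc zero} _   = toℕ<n c
  pos≤upper {z}        {zero}     _   = pos≤1+m z
  pos≤upper {z}        {inner _}  _   = pos≤1+m z

  broad : Vertex → Vertex → Interval
  broad x y = lower x ⊔ lower y , upper x ⊓ upper y

  broad-lower≤broad-upper : ∀ x y x′ y′ → lower x ⊔ lower y ≤ upper x′ ⊓ upper y′
  broad-lower≤broad-upper x y x′ y′ =
    ≤-trans (⊔-lub (lower≤1 x) (lower≤1 y)) (≤-trans 1≤m (⊓-glb (m≤upper x′) (m≤upper y′)))

  broad-overlap : ∀ x y x′ y′ → Overlap (broad x y) (broad x′ y′)
  broad-overlap x y x′ y′ = broad-lower≤broad-upper x y x′ y′ , broad-lower≤broad-upper x′ y′ x y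

  point-overlap-broad : ∀ {z x y} → z ≢ x → z ≢ y → Overlap (point (pos z)) (broad x y)
  point-overlap-broad z≢x z≢y =
    ⊓-glb (pos≤upper z≢x) (pos≤upper z≢y) , ⊔-lub (lower≤pos z≢x) (lower≤pos z≢y)

  outer-point-outside-broad : ∀ {s} → Outer s → ∀ y → ¬ Overlap (point (pos s)) (broad s y)
  outer-point-outside-broad outer-a y (_ , 1⊔lower≤0) with ≤-trans (m≤m⊔n 1 (lower y)) 1⊔lower≤0
  ... | ()
  outer-point-outside-broad outer-b y (1+m≤m⊓upper , _) = <-irrefl refl (≤-trans 1+m≤m⊓upper (m⊓n≤m m (upper y)))

  interval : Fin m → Vertex → Vertex → Interval
  interval k x y with x ≟ inner k | y ≟ inner k
  ... | yes _ | _     = point (pos y)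
  ... | no _  | yes _ = point (pos x)
  ... | no _  | no _  = broad x y

  data IntervalView (k : Fin m) (x y : Vertex) : Interval → Set where
    through-left  : x ≡ inner k → IntervalView k x y (point (pos y))
    through-right : x ≢ inner k → y ≡ inner k → IntervalView k x y (point (pos x))
    avoiding      : x ≢ inner k → y ≢ inner k → IntervalView k x y (broad x y)

  interval-view : ∀ k x y → IntervalView k x y (interval k x y)
  interval-view k x y with x ≟ inner k | y ≟ inner k
  ... | yes x≡c | _     = through-left x≡c
  ... | no x≢c  | yes y≡c = through-right x≢c y≡c
  ... | no x≢c  | no y≢c  = avoiding x≢c y≢c

  interval-nonempty : ∀ k x y → proj₁ (interval k x y) ≤ proj₂ (interval k x y)
  interval-nonempty k x y with interval k x y | interval-view k x y
  ... | _ | through-left _    = ≤-refl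
  ... | _ | through-right _ _ = ≤-refl
  ... | _ | avoiding _ _      = broad-lower≤broad-upper x y x y

  interval-comm : ∀ k {x y} → x ≢ y → interval k x y ≡ interval k y x
  interval-comm k {x} {y} x≢y with interval k x y | interval-view k x y | interval k y x | interval-view k y x
  ... | _ | through-left x≡c    | _ | through-left y≡c    = ⊥-elim (x≢y (trans x≡c (sym y≡c)))
  ... | _ | through-left _      | _ | through-right _ _   = refl
  ... | _ | through-left x≡c    | _ | avoiding _ x≢c      = ⊥-elim (x≢c x≡c)
  ... | _ | through-right _ _   | _ | through-left _      = refl
  ... | _ | through-right _ y≡c | _ | through-right y≢c _ = ⊥-elim (y≢c y≡c)
  ... | _ | through-right _ y≡c | _ | avoiding y≢c _      = ⊥-elim (y≢c y≡c)
  ... | _ | avoiding _ y≢c      | _ | through-left y≡c    = ⊥-elim (y≢c y≡c)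
  ... | _ | avoiding x≢c _      | _ | through-right _ x≡c = ⊥-elim (x≢c x≡c)
  ... | _ | avoiding _ _        | _ | avoiding _ _        = cong₂ _,_ (⊔-comm (lower x) (lower y)) (⊓-comm (upper x) (upper y))

  interval-from-inner : ∀ k y → interval k (inner k) y ≡ point (pos y)
  interval-from-inner k y with interval k (inner k) y | interval-view k (inner k) y
  ... | _ | through-left _      = refl
  ... | _ | through-right c≢c _ = ⊥-elim (c≢c refl)
  ... | _ | avoiding c≢c _      = ⊥-elim (c≢c refl)

  interval-to-inner : ∀ k {x} → x ≢ inner k → interval k x (inner k) ≡ point (pos x)
  interval-to-inner k {x} x≢c = trans (interval-comm k x≢c) (interval-from-inner k x)

  interval-avoiding : ∀ k {x y} → x ≢ inner k → y ≢ inner k → interval k x y ≡ broad x y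
  interval-avoiding k {x} {y} x≢c y≢c with interval k x y | interval-view k x y
  ... | _ | through-left x≡c    = ⊥-elim (x≢c x≡c)
  ... | _ | through-right _ y≡c = ⊥-elim (y≢c y≡c)
  ... | _ | avoiding _ _        = refl

  disjoint-overlap : ∀ k {x y x′ y′} → x ≢ x′ → x ≢ y′ → y ≢ x′ → y ≢ y′ →
                     Overlap (interval k x y) (interval k x′ y′)
  disjoint-overlap k {x} {y} {x′} {y′} x≢x′ x≢y′ y≢x′ y≢y′
    with interval k x y | interval-view k x y | interval k x′ y′ | interval-view k x′ y′
  ... | _ | through-left x≡c    | _ | through-left x′≡c    = ⊥-elim (x≢x′ (trans x≡c (sym x′≡c)))
  ... | _ | through-left x≡c    | _ | through-right _ y′≡c = ⊥-elim (x≢y′ (trans x≡c (sym y′≡c)))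
  ... | _ | through-left _      | _ | avoiding _ _         = point-overlap-broad y≢x′ y≢y′
  ... | _ | through-right _ y≡c | _ | through-left x′≡c    = ⊥-elim (y≢x′ (trans y≡c (sym x′≡c)))
  ... | _ | through-right _ y≡c | _ | through-right _ y′≡c = ⊥-elim (y≢y′ (trans y≡c (sym y′≡c)))
  ... | _ | through-right _ _   | _ | avoiding _ _         = point-overlap-broad x≢x′ x≢y′
  ... | _ | avoiding _ _        | _ | through-left _       = overlap-sym (point-overlap-broad (≢-sym x≢y′) (≢-sym y≢y′))
  ... | _ | avoiding _ _        | _ | through-right _ _    = overlap-sym (point-overlap-broad (≢-sym x≢x′) (≢-sym y≢x′))
  ... | _ | avoiding _ _        | _ | avoiding _ _         = broad-overlap x y x′ y′

  inner-apart : ∀ k {y y′} → y ≢ y′ → ¬ Overlap (interval k (inner k) y) (interval k (inner k) y′)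
  inner-apart k {y} {y′} y≢y′ rewrite interval-from-inner k y | interval-from-inner k y′ =
    λ meeting → y≢y′ (pos-injective (overlapping-points-≡ meeting))

  outer-≢-inner : ∀ {s} → Outer s → ∀ c → s ≢ inner c
  outer-≢-inner outer-a c ()
  outer-≢-inner outer-b c ()

  outer-apart : ∀ c {s y} → Outer s → y ≢ inner c → ¬ Overlap (interval c s (inner c)) (interval c s y)
  outer-apart c {y = y} o y≢c
    rewrite interval-to-inner c (outer-≢-inner o c) | interval-avoiding c (outer-≢-inner o c) y≢c =
    outer-point-outside-broad o y

  separate-outer : ∀ {s y y′} → Outer s → s ≢ y → s ≢ y′ → y ≢ y′ →
                   ∃[ k ] ¬ Overlap (interval k s y) (interval k s y′)
  separate-outer {y = inner c}              o       _   _    y≢y′ = c , outer-apart c o (≢-sym y≢y′)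
  separate-outer {y′ = inner c}             o       _   _    y≢y′ = c , λ meeting → outer-apart c o y≢y′ (overlap-sym meeting)
  separate-outer {y = zero}                 outer-a s≢y _    _    = ⊥-elim (s≢y refl)
  separate-outer {y′ = zero}                outer-a _   s≢y′ _    = ⊥-elim (s≢y′ refl)
  separate-outer {y = suc zero}             outer-b s≢y _    _    = ⊥-elim (s≢y refl)
  separate-outer {y′ = suc zero}            outer-b _   s≢y′ _    = ⊥-elim (s≢y′ refl)
  separate-outer {y = suc zero} {suc zero}  outer-a _   _    y≢y′ = ⊥-elim (y≢y′ refl)
  separate-outer {y = zero}     {zero}      outer-b _   _    y≢y′ = ⊥-elim (y≢y′ refl)

  separate : ∀ {s y y′} → s ≢ y → s ≢ y′ → y ≢ y′ → ∃[ k ] ¬ Overlap (interval k s y) (interval k s y′)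
  separate {zero}     = separate-outer outer-a
  separate {suc zero} = separate-outer outer-b
  separate {inner c} _ _ y≢y′ = c , inner-apart c y≢y′

  edge-interval : Edge (suc (suc m)) → Fin m → Interval
  edge-interval e k = interval k (i e) (j e)

  edge-interval-ends : ∀ {e x y} → Ends e x y → ∀ k → edge-interval e k ≡ interval k x y
  edge-interval-ends     forward  k = refl
  edge-interval-ends {e} backward k = interval-comm k (i≢j e)

  edge-interval-nonempty : ∀ e k → proj₁ (edge-interval e k) ≤ proj₂ (edge-interval e k)
  edge-interval-nonempty e k = interval-nonempty k (i e) (j e)

  edge-box : Edge (suc (suc m)) → Box m
  edge-box e = boxOf (edge-interval e) (edge-interval-nonempty e)

  complement-LKn-isBoxRep : IsBoxRep (complement (LKn (suc (suc m)))) m edge-box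
  complement-LKn-isBoxRep =
    complement-isBoxRep (LKn (suc (suc m))) edge-interval edge-interval-nonempty meet apart
    where
    meet : ∀ e f → e ≢ f → ¬ (e ≢ f × ShareEnd e f) → ∀ k → Overlap (edge-interval e k) (edge-interval f k)
    meet e f e≢f ¬adj k = disjoint-overlap k
      (λ p → ¬adj (e≢f , inj₁ p)) (λ p → ¬adj (e≢f , inj₂ (inj₁ p)))
      (λ p → ¬adj (e≢f , inj₂ (inj₂ (inj₁ p)))) (λ p → ¬adj (e≢f , inj₂ (inj₂ (inj₂ p))))

    apart : ∀ e f → e ≢ f → e ≢ f × ShareEnd e f → ∃[ k ] ¬ Overlap (edge-interval e k) (edge-interval f k)
    apart e f e≢f (_ , shared) with shared-endpoint e≢f shared
    ... | s , y , y′ , e-ends , f-ends , y≢y′ with separate (ends-≢ e-ends) (ends-≢ f-ends) y≢y′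
    ... | k , ¬overlap =
      k , λ meeting → ¬overlap (subst₂ Overlap (edge-interval-ends e-ends k) (edge-interval-ends f-ends k) meeting)

complement-LKn-boxicity : ∀ m → 1 ≤ m → BoxicityAtMost (complement (LKn (suc (suc m)))) m
complement-LKn-boxicity m 1≤m = m , ≤-refl , edge-box , complement-LKn-isBoxRep
  where open KneserBoxes m 1≤m

lemma8 : (n : ℕ) → 5 ≤ n → BoxicityAtMost (complement (LKn n)) (n ∸ 2)
lemma8 (suc (suc m)) (s≤s (s≤s 3≤m)) = complement-LKn-boxicity m (≤-trans (s≤s z≤n) 3≤m)
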